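{- Let $G$ be a Muller game and $\sigma$ a player such that $W_{G,\sigma}\neq\emptyset$ and $\sigma$ has a memoryless winning strategy. Then $\sigma$ has a winning strategy in the trap-depth game on $G$ in which $\sigma$ goes first.
   Context: A Muller game $G=(V,V_{\mathrm{red}},E,\mathcal R)$ consists of a finite directed graph $(V,E)$ in which every vertex has an outgoing edge, a set $V_{\mathrm{red}}$ of Red's vertices (the others are Blue's) and $\mathcal R\subseteq 2^V$; Red wins an infinite play iff its set of infinitely often visited vertices lies in $\mathcal R$. $\overline\sigma$ is the opponent of $\sigma$; $R_\sigma=\mathcal R$ for Red and $2^V\setminus\mathcal R$ for Blue. $W_{G,\sigma}$ is the set of vertices from which $\sigma$ has a winning strategy; a memoryless winning strategy is a strategy depending only on the current vertex that wins from every vertex of $W_{G,\sigma}$. A $\sigma$-trap is a set $X$ in which every $\sigma$-vertex has all successors in $X$ and every $\overline\sigma$-vertex has some successor in $X$; $\mathrm{Traps}_\sigma(G)$ denotes the nonempty $\sigma$-traps; $G[X]$ is the induced game. The trap-depth game on $G$ in which $\sigma$ goes first: $G_1=G$; in round $i\ge1$, $\sigma$ picks $X_i\in\mathrm{Traps}_{\overline\sigma}(G_i)$ with $X_i\in R_\sigma$, then $\overline\sigma$ picks $Y_i\in\mathrm{Traps}_\sigma(G_i[X_i])$ with $Y_i\in R_{\overline\sigma}$, and $G_{i+1}=G_i[Y_i]$; the first player with no legal move loses. -}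

module Defs where

open import Data.Nat using (ℕ; zero; suc; _≤_)
open import Data.Fin using (Fin)
open import Data.Fin.Subset using (Subset; _∈_; _∉_; _⊆_; Nonempty; ⊤)
open import Data.Bool using (Bool; true; false; not; if_then_else_)
open import Data.List using (List; []; _∷ʳ_)
open import Data.Product using (Σ; ∃; _×_; _,_)
open import Relation.Binary.PropositionalEquality using (_≡_; _≢_)
open import Function.Bundles using (_⇔_)

data Player : Set where
  red blue : Player

opp : Player → Player
opp red = blue
opp blue = red

-- Vertex v belongs to Red iff isRed v ≡ true; there is an edge u → v iff edge u v ≡ true;
-- the Muller condition is 𝓡 ⊆ 2^V, given by its (Boolean) characteristic function.
record MullerGame : Set where
  field
    n      : ℕ
    isRed  : Fin n → Bool
    edge   : Fin n → Fin n → Bool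
    total  : ∀ v → ∃ λ w → edge v w ≡ true
    𝓡      : Subset n → Bool

module _ (G : MullerGame) where
  open MullerGame G

  owner : Fin n → Player
  owner v = if isRed v then red else blue

  R : Player → Subset n → Bool
  R red  X = 𝓡 X
  R blue X = not (𝓡 X)

  Play : Set
  Play = ℕ → Fin n

  InfOften : Play → Fin n → Set
  InfOften p v = ∀ k → ∃ λ m → k ≤ m × p m ≡ v

  WinsPlay : Player → Play → Set
  WinsPlay σ p = ∃ λ (S : Subset n) → (∀ v → (v ∈ S) ⇔ InfOften p v) × R σ S ≡ true

  -- history p(0) … p(i-1)
  prefix : Play → ℕ → List (Fin n)
  prefix p zero = []
  prefix p (suc i) = prefix p i ∷ʳ p i

  Strategy : Set
  Strategy = List (Fin n) → Fin n → Fin n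

  Legal : Player → Strategy → Set
  Legal σ s = ∀ h v → owner v ≡ σ → edge v (s h v) ≡ true

  ConsistentFrom : Player → Strategy → Fin n → Play → Set
  ConsistentFrom σ s v₀ p =
    (p 0 ≡ v₀) × (∀ i → edge (p i) (p (suc i)) ≡ true)
      × (∀ i → owner (p i) ≡ σ → p (suc i) ≡ s (prefix p i) (p i))

  WinningFrom : Player → Strategy → Fin n → Set
  WinningFrom σ s v₀ = ∀ p → ConsistentFrom σ s v₀ p → WinsPlay σ p

  InWinningRegion : Player → Fin n → Set
  InWinningRegion σ v = ∃ λ s → Legal σ s × WinningFrom σ s v

  HasMemorylessWinningStrategy : Player → Set
  HasMemorylessWinningStrategy σ =
    ∃ λ (m : Fin n → Fin n) →
      (∀ v → owner v ≡ σ → edge v (m v) ≡ true)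
      × (∀ v → InWinningRegion σ v → WinningFrom σ (λ _ → m) v)

  IsTrap : Player → Subset n → Subset n → Set
  IsTrap σ U X =
    X ⊆ U × Nonempty X
      × (∀ v → v ∈ X → owner v ≡ σ → ∀ w → w ∈ U → edge v w ≡ true → w ∈ X)
      × (∀ v → v ∈ X → owner v ≢ σ → ∃ λ w → w ∈ X × edge v w ≡ true)

  -- TDWin σ U : σ, about to move in the trap-depth game whose current arena is G[U],
  -- has a winning strategy (the game is finite: Y_i ⊊ X_i ⊆ U_i, so winning
  -- strategies are exactly well-founded strategy trees).
  data TDWin (σ : Player) : Subset n → Set where
    tdwin : ∀ {U} (X : Subset n) → IsTrap (opp σ) U X → R σ X ≡ true
          → (∀ Y → IsTrap σ X Y → R (opp σ) Y ≡ true → TDWin σ Y)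
          → TDWin σ U

  WinsTrapDepthGame : Player → Set
  WinsTrapDepthGame σ = TDWin σ ⊤

-- Fix a memoryless strategy m of σ that wins from every winning vertex. In any
-- subarena U that m never leaves, in which the opponent can always stay, and which
-- contains a winning vertex v, consider the graph of m-consistent moves inside U.
-- Some terminal strongly connected component is reachable from v; its vertex set X
-- is a trap for the opponent, and a play that follows m and cycles through all of X
-- starts at a winning vertex, so X ∈ R_σ. Any answer Y of the opponent is a σ-trap
-- inside X with Y ∈ R_σ̄, hence Y ⊊ X, and Y again satisfies the three conditions.
-- Well-founded induction on ⊊ therefore yields a winning strategy for σ.
module Submission where

open import Defs
open import Data.Product using (∃)

open import Level using (Level; 0ℓ; _⊔_)
open import Data.Nat using (ℕ; zero; suc; _+_; _≤_; z≤n; s≤s)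
open import Data.Nat.Properties using (≤-trans; ≤-<-trans; m≤n+m; <⇒≱)
open import Data.Nat.GeneralisedArithmetic using (fold)
open import Data.Fin using (Fin; zero; suc)
open import Data.Fin.Properties using (_≟_; any?)
open import Data.Fin.Subset
  using (Subset; _∈_; _⊆_; _⊂_; _∪_; ⁅_⁆; ⊤; ∣_∣)
open import Data.Fin.Subset.Properties
  using (_∈?_; _⊂?_; ⊆-antisym; ⊂-⊆-trans; p⊆p∪q; x∈p∪q⁺; x∈p∪q⁻; ∈⊤; x∈⁅x⁆; x∈⁅y⁆⇒x≡y;
         ∣p∣≤n; p⊂q⇒∣p∣<∣q∣)
open import Data.Fin.Subset.Induction using (⊂-wellFounded)
open import Data.Bool using (true; not)
open import Data.Bool.Properties using (not-¬; not-involutive) renaming (_≟_ to _≟ᵇ_)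
open import Data.List using (List; []; _∷_; allFin)
open import Data.List.Membership.Propositional using () renaming (_∈_ to _∈ˡ_)
open import Data.List.Membership.Propositional.Properties using (∈-allFin)
open import Data.List.Relation.Unary.Any using () renaming (here to hereˡ; there to thereˡ)
open import Data.Vec using ([]; _∷_; here; there)
open import Data.Product using (_×_; _,_; proj₁; proj₂)
open import Function using (_∘_)
open import Data.Sum using (_⊎_; inj₁; inj₂; map₂)
open import Data.Empty using (⊥-elim)
open import Relation.Nullary using (Dec; yes; no; ¬_; does; ¬?)
open import Relation.Nullary.Decidable using (_×-dec_; _→-dec_; decidable-stable)
import Relation.Nullary.Decidable as Dec
open import Relation.Unary using (Pred)
open import Relation.Binary using (Rel; Decidable)
open import Relation.Binary.Construct.Closure.ReflexiveTransitive using (Star; ε; _◅_; _◅◅_; return)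
open import Relation.Binary.PropositionalEquality using (_≡_; _≢_; refl; sym; trans; cong; subst)
open import Induction.WellFounded using (Acc; acc)
open import Function.Bundles using (_⇔_; mk⇔; Equivalence)
import Function.Properties.Equivalence as ⇔

private
  variable
    a ℓ : Level
    A : Set a

fromDecidable : ∀ {n} {P : Pred (Fin n) ℓ} → (∀ x → Dec (P x)) → Subset n
fromDecidable {n = zero}  P? = []
fromDecidable {n = suc n} P? = does (P? zero) ∷ fromDecidable (λ x → P? (suc x))

∈fromDecidable⇔ : ∀ {n} {P : Pred (Fin n) ℓ} (P? : ∀ x → Dec (P x)) {x : Fin n} →
                  x ∈ fromDecidable P? ⇔ P x
∈fromDecidable⇔ P? = mk⇔ (to P?) (from P?)
  where
    to : ∀ {n} {P : Pred (Fin n) ℓ} (P? : ∀ x → Dec (P x)) {x} → x ∈ fromDecidable P? → P x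
    to P? {zero} x∈ with P? zero | x∈
    ... | yes px | _ = px
    ... | no _   | ()
    to P? {suc x} (there x∈) = to (λ x → P? (suc x)) x∈

    from : ∀ {n} {P : Pred (Fin n) ℓ} (P? : ∀ x → Dec (P x)) {x} → P x → x ∈ fromDecidable P?
    from P? {zero} px with P? zero
    ... | yes _  = here
    ... | no ¬px = ⊥-elim (¬px px)
    from P? {suc x} px = there (from (λ x → P? (suc x)) px)

⊆∧⊄⇒⊇ : ∀ {n} {p q : Subset n} → p ⊆ q → ¬ (p ⊂ q) → q ⊆ p
⊆∧⊄⇒⊇ {p = p} p⊆q p⊄q {x} x∈q with x ∈? p
... | yes x∈p = x∈p
... | no  x∉p = ⊥-elim (p⊄q (p⊆q , x , x∈q , x∉p))

-- An inflationary map on Subset n strictly grows its argument until it reaches a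
-- fixed point, and a chain of strict growth has length at most n.
module InflationaryIteration {n} (f : Subset n → Subset n) (inflationary : ∀ S → S ⊆ f S) where

  ⊆-fold : ∀ S k → S ⊆ fold S f k
  ⊆-fold S zero    = λ x∈ → x∈
  ⊆-fold S (suc k) = λ x∈ → inflationary (fold S f k) (⊆-fold S k x∈)

  private
    grows-or-fixed : ∀ S k → k ≤ ∣ fold S f k ∣ ⊎ f (fold S f k) ≡ fold S f k
    grows-or-fixed S zero = inj₁ z≤n
    grows-or-fixed S (suc k) with grows-or-fixed S k
    ... | inj₂ fixed = inj₂ (cong f fixed)
    ... | inj₁ k≤∣T∣ with fold S f k ⊂? f (fold S f k)
    ...   | yes T⊂fT = inj₁ (≤-<-trans k≤∣T∣ (p⊂q⇒∣p∣<∣q∣ T⊂fT))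
    ...   | no  T⊄fT = inj₂ (cong f (⊆-antisym (⊆∧⊄⇒⊇ (inflationary _) T⊄fT) (inflationary _)))

  fold-fixed : ∀ S → f (fold S f (suc n)) ≡ fold S f (suc n)
  fold-fixed S with grows-or-fixed S (suc n)
  ... | inj₁ n<∣T∣ = ⊥-elim (<⇒≱ n<∣T∣ (∣p∣≤n (fold S f (suc n))))
  ... | inj₂ fixed = fixed

InfinitelyOften : {A : Set a} → (ℕ → A) → A → Set a
InfinitelyOften f x = ∀ k → ∃ λ i → k ≤ i × f i ≡ x

_∷ₛ_ : A → (ℕ → A) → ℕ → A
(x ∷ₛ f) zero    = x
(x ∷ₛ f) (suc i) = f i

infinitelyOften-∷ₛ : (x : A) (f : ℕ → A) {y : A} →
                     InfinitelyOften (x ∷ₛ f) y ⇔ InfinitelyOften f y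
infinitelyOften-∷ₛ x f = mk⇔ to from
  where
    to : ∀ {y} → InfinitelyOften (x ∷ₛ f) y → InfinitelyOften f y
    to inf k with inf (suc k)
    ... | suc i , s≤s k≤i , fi≡y = i , k≤i , fi≡y

    from : ∀ {y} → InfinitelyOften f y → InfinitelyOften (x ∷ₛ f) y
    from inf k with inf k
    ... | i , k≤i , fi≡y = suc i , ≤-trans k≤i (m≤n+m i 1) , fi≡y

periodic⇒infinitelyOften : (f : ℕ → A) (p : ℕ) → (∀ i → f (suc p + i) ≡ f i) →
                           ∀ j → InfinitelyOften f (f j)
periodic⇒infinitelyOften f p periodic j zero = j , z≤n , refl
periodic⇒infinitelyOften f p periodic j (suc k)
  with periodic⇒infinitelyOften f p periodic j k
... | i , k≤i , fi≡fj = suc p + i , s≤s (≤-trans k≤i (m≤n+m i p)) , trans (periodic i) fi≡fj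

module Reachability {n ℓ} (_⟶_ : Rel (Fin n) ℓ) (_⟶?_ : Decidable _⟶_) where

  _⟶*_ : Rel (Fin n) ℓ
  _⟶*_ = Star _⟶_

  Closed : ∀ {p} → Pred (Fin n) p → Set (ℓ ⊔ p)
  Closed P = ∀ {v w} → P v → v ⟶ w → P w

  closed-⟶* : ∀ {p} {P : Pred (Fin n) p} → Closed P → ∀ {v w} → P v → v ⟶* w → P w
  closed-⟶* closed Pv ε              = Pv
  closed-⟶* closed Pv (v⟶u ◅ u⟶*w) = closed-⟶* closed (closed Pv v⟶u) u⟶*w

  successors : Subset n → Subset n
  successors S = fromDecidable (λ w → any? (λ v → (v ∈? S) ×-dec (v ⟶? w)))

  ∈successors : ∀ {S v w} → v ∈ S → v ⟶ w → w ∈ successors S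
  ∈successors v∈S v⟶w = Equivalence.from (∈fromDecidable⇔ _) (_ , v∈S , v⟶w)

  expand : Subset n → Subset n
  expand S = S ∪ successors S

  open InflationaryIteration expand (λ S → p⊆p∪q (successors S))

  reach : Fin n → Subset n
  reach v = fold ⁅ v ⁆ expand (suc n)

  reach-closed : ∀ {v} → Closed (_∈ reach v)
  reach-closed {v} u∈ u⟶w =
    subst (_ ∈_) (fold-fixed ⁅ v ⁆) (x∈p∪q⁺ (inj₂ (∈successors u∈ u⟶w)))

  private
    ∈fold⇒⟶* : ∀ {v w} k → w ∈ fold ⁅ v ⁆ expand k → v ⟶* w
    ∈fold⇒⟶* {v} zero w∈ rewrite x∈⁅y⁆⇒x≡y v w∈ = ε
    ∈fold⇒⟶* {v} (suc k) w∈ with x∈p∪q⁻ (fold ⁅ v ⁆ expand k) _ w∈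
    ... | inj₁ w∈T = ∈fold⇒⟶* k w∈T
    ... | inj₂ w∈succ with Equivalence.to (∈fromDecidable⇔ _) w∈succ
    ...   | u , u∈T , u⟶w = ∈fold⇒⟶* k u∈T ◅◅ return u⟶w

  ∈reach⇔ : ∀ {v w} → w ∈ reach v ⇔ v ⟶* w
  ∈reach⇔ {v} = mk⇔ (∈fold⇒⟶* (suc n)) (closed-⟶* reach-closed (⊆-fold ⁅ v ⁆ (suc n) (x∈⁅x⁆ v)))

  _⟶*?_ : Decidable _⟶*_
  v ⟶*? w = Dec.map ∈reach⇔ (w ∈? reach v)

  Terminal : Fin n → Set ℓ
  Terminal y = ∀ {z} → y ⟶* z → z ⟶* y

  terminal-reachable : ∀ v → ∃ λ y → v ⟶* y × Terminal y
  terminal-reachable v = descend v (⊂-wellFounded (reach v))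
    where
      -- Escaping to a z that cannot reach back shrinks the reachable set, as v leaves it.
      descend : ∀ v → Acc _⊂_ (reach v) → ∃ λ y → v ⟶* y × Terminal y
      descend v (acc smaller) with any? (λ z → (v ⟶*? z) ×-dec ¬? (z ⟶*? v))
      ... | no no-escape =
        v , ε , λ {z} v⟶*z → decidable-stable (z ⟶*? v) (λ z↛v → no-escape (z , v⟶*z , z↛v))
      ... | yes (z , v⟶*z , z↛v) with descend z (smaller reach-z⊂reach-v)
        where
          open Equivalence
          reach-z⊂reach-v : reach z ⊂ reach v
          reach-z⊂reach-v = (λ x∈ → from ∈reach⇔ (v⟶*z ◅◅ to ∈reach⇔ x∈))
                          , v , from ∈reach⇔ ε , λ v∈ → z↛v (to ∈reach⇔ v∈)
      ...   | y , z⟶*y , terminal = y , v⟶*z ◅◅ z⟶*y , terminal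

  targets : ∀ {u w} → u ⟶* w → List (Fin n)
  targets ε                   = []
  targets (_◅_ {j = x} _ x⟶*w) = x ∷ targets x⟶*w

  ∈targets-◅◅ˡ : ∀ {u v w x} (p : u ⟶* v) {q : v ⟶* w} → x ∈ˡ targets p → x ∈ˡ targets (p ◅◅ q)
  ∈targets-◅◅ˡ (_ ◅ p) (hereˡ refl) = hereˡ refl
  ∈targets-◅◅ˡ (_ ◅ p) (thereˡ x∈)  = thereˡ (∈targets-◅◅ˡ p x∈)

  ∈targets-◅◅ʳ : ∀ {u v w x} (p : u ⟶* v) {q : v ⟶* w} → x ∈ˡ targets q → x ∈ˡ targets (p ◅◅ q)
  ∈targets-◅◅ʳ ε       x∈ = x∈
  ∈targets-◅◅ʳ (_ ◅ p) x∈ = thereˡ (∈targets-◅◅ʳ p x∈)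

  end∈targets : ∀ {u w} (p : u ⟶* w) → u ≡ w ⊎ w ∈ˡ targets p
  end∈targets ε       = inj₁ refl
  end∈targets (_ ◅ p) with end∈targets p
  ... | inj₁ refl = inj₂ (hereˡ refl)
  ... | inj₂ w∈   = inj₂ (thereˡ w∈)

  module Lasso {y c} (s : y ⟶ c) (r : c ⟶* y) where

    walk : ∀ {u} → u ⟶* y → ℕ → Fin n
    walk {u} _ zero    = u
    walk ε       (suc i) = walk r i
    walk (_ ◅ p) (suc i) = walk p i

    walk-⟶ : ∀ {u} (p : u ⟶* y) i → walk p i ⟶ walk p (suc i)
    walk-⟶ ε         zero    = s
    walk-⟶ (u⟶x ◅ p) zero    = u⟶x
    walk-⟶ ε         (suc i) = walk-⟶ r i
    walk-⟶ (_ ◅ p)   (suc i) = walk-⟶ p i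

    walk-rejoins : ∀ {u} (p : u ⟶* y) → ∃ λ k → ∀ i → walk p (k + i) ≡ walk ε i
    walk-rejoins ε       = 0 , λ _ → refl
    walk-rejoins (_ ◅ p) with walk-rejoins p
    ... | k , rejoins = suc k , rejoins

    walk-visits : ∀ {u v} (p : u ⟶* y) → v ∈ˡ u ∷ targets p → ∃ λ j → walk p j ≡ v
    walk-visits p       (hereˡ refl) = 0 , refl
    walk-visits (_ ◅ p) (thereˡ v∈)  with walk-visits p v∈
    ... | j , visits = suc j , visits

    reachable-walk : ∀ i → y ⟶* walk ε i
    reachable-walk zero    = ε
    reachable-walk (suc i) = reachable-walk i ◅◅ return (walk-⟶ ε i)

  module Tour {y} (terminal : Terminal y) where

    tour : List (Fin n) → y ⟶* y
    tour []       = ε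
    tour (w ∷ ws) with y ⟶*? w
    ... | yes y⟶*w = y⟶*w ◅◅ terminal y⟶*w ◅◅ tour ws
    ... | no  _    = tour ws

    tour-covers : ∀ ws {w} → w ∈ˡ ws → y ⟶* w → y ≡ w ⊎ w ∈ˡ targets (tour ws)
    tour-covers (x ∷ ws) w∈ y⟶*w with y ⟶*? x
    tour-covers (x ∷ ws) w∈ y⟶*w | no y↛x with w∈
    ... | hereˡ refl  = ⊥-elim (y↛x y⟶*w)
    ... | thereˡ w∈ws = tour-covers ws w∈ws y⟶*w
    tour-covers (x ∷ ws) w∈ y⟶*w | yes y⟶*x with w∈
    ... | hereˡ refl  = map₂ (∈targets-◅◅ˡ y⟶*x) (end∈targets y⟶*x)
    ... | thereˡ w∈ws = map₂ (∈targets-◅◅ʳ y⟶*x ∘ ∈targets-◅◅ʳ (terminal y⟶*x))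
                             (tour-covers ws w∈ws y⟶*w)

  terminal-recurrentWalk : ∀ {y c} → Terminal y → y ⟶ c →
    ∃ λ (f : ℕ → Fin n) → f 0 ≡ y × (∀ i → f i ⟶ f (suc i))
                        × (∀ w → InfinitelyOften f w ⇔ y ⟶* w)
  terminal-recurrentWalk {y} {c} terminal y⟶c =
    walk ε , refl , walk-⟶ ε , λ w → mk⇔ (visited⇒reachable w) (reachable⇒visited w)
    where
      open Tour terminal

      back : c ⟶* y
      back = terminal (return y⟶c) ◅◅ tour (allFin n)

      open Lasso y⟶c back

      lap : ℕ
      lap = proj₁ (walk-rejoins back)

      period : ∀ i → walk ε (suc lap + i) ≡ walk ε i
      period = proj₂ (walk-rejoins back)

      visited⇒reachable : ∀ w → InfinitelyOften (walk ε) w → y ⟶* w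
      visited⇒reachable w inf with inf 0
      ... | i , _ , refl = reachable-walk i

      reachable⇒visited : ∀ w → y ⟶* w → InfinitelyOften (walk ε) w
      reachable⇒visited w y⟶*w with tour-covers (allFin n) (∈-allFin w) y⟶*w
      ... | inj₁ refl = periodic⇒infinitelyOften (walk ε) lap period 0
      ... | inj₂ w∈tour with walk-visits back (thereˡ (∈targets-◅◅ʳ (terminal (return y⟶c)) w∈tour))
      ...   | j , refl = periodic⇒infinitelyOften (walk ε) lap period (suc j)

_≟ₚ_ : (σ τ : Player) → Dec (σ ≡ τ)
red  ≟ₚ red  = yes refl
red  ≟ₚ blue = no λ ()
blue ≟ₚ red  = no λ ()
blue ≟ₚ blue = yes refl

≡opp⇒≢ : ∀ {τ σ} → τ ≡ opp σ → τ ≢ σ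
≡opp⇒≢ {σ = red}  refl ()
≡opp⇒≢ {σ = blue} refl ()

≢opp⇒≡ : ∀ {τ σ} → τ ≢ opp σ → τ ≡ σ
≢opp⇒≡ {red}  {red}  _     = refl
≢opp⇒≡ {red}  {blue} τ≢opp = ⊥-elim (τ≢opp refl)
≢opp⇒≡ {blue} {red}  τ≢opp = ⊥-elim (τ≢opp refl)
≢opp⇒≡ {blue} {blue} _     = refl

R-opp : ∀ G σ S → R G (opp σ) S ≡ not (R G σ S)
R-opp G red  S = refl
R-opp G blue S = sym (not-involutive _)

R-opp-disjoint : ∀ G σ S → R G σ S ≡ true → R G (opp σ) S ≢ true
R-opp-disjoint G σ S Rσ Rσ̄ = not-¬ refl (trans Rσ (trans (sym Rσ̄) (R-opp G σ S)))

⊆-R-opp⇒⊂ : ∀ G σ {X Y} → Y ⊆ X → R G σ X ≡ true → R G (opp σ) Y ≡ true → Y ⊂ X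
⊆-R-opp⇒⊂ G σ {X} {Y} Y⊆X Rσ Rσ̄ with Y ⊂? X
... | yes Y⊂X = Y⊂X
... | no  Y⊄X = ⊥-elim (R-opp-disjoint G σ X Rσ (subst (λ T → R G (opp σ) T ≡ true) Y≡X Rσ̄))
  where
    Y≡X : Y ≡ X
    Y≡X = ⊆-antisym Y⊆X (⊆∧⊄⇒⊇ Y⊆X Y⊄X)

module MemorylessStrategy (G : MullerGame) (σ : Player) (m : Fin (MullerGame.n G) → Fin (MullerGame.n G))
                          (m-legal : ∀ v → owner G v ≡ σ → MullerGame.edge G v (m v) ≡ true) where
  open MullerGame G

  _⟶ₘ_ : Rel (Fin n) 0ℓ
  v ⟶ₘ w = edge v w ≡ true × (owner G v ≡ σ → w ≡ m v)

  _⟶ₘ?_ : Decidable _⟶ₘ_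
  v ⟶ₘ? w = (edge v w ≟ᵇ true) ×-dec ((owner G v ≟ₚ σ) →-dec (w ≟ m v))

  Winning : Fin n → Set
  Winning = WinningFrom G σ (λ _ → m)

  winning-⟶ₘ : ∀ {v w} → v ⟶ₘ w → Winning v → Winning w
  winning-⟶ₘ {v} (v⟶w , follows-m) v-wins p (p0≡w , p-edges , p-follows-m)
    with v-wins (v ∷ₛ p) (refl , edges , moves)
    where
      edges : ∀ i → edge ((v ∷ₛ p) i) ((v ∷ₛ p) (suc i)) ≡ true
      edges zero    rewrite p0≡w = v⟶w
      edges (suc i) = p-edges i

      moves : ∀ i → owner G ((v ∷ₛ p) i) ≡ σ → (v ∷ₛ p) (suc i) ≡ m ((v ∷ₛ p) i)
      moves zero    σ-owns = trans p0≡w (follows-m σ-owns)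
      moves (suc i) σ-owns = p-follows-m i σ-owns
  ... | S , S⇔inf , RS = S , (λ u → ⇔.trans (S⇔inf u) (infinitelyOften-∷ₛ v p)) , RS

  _⟶[_]_ : Fin n → Subset n → Fin n → Set
  v ⟶[ U ] w = w ∈ U × v ⟶ₘ w

  ⟶[_]? : ∀ U → Decidable (λ v w → v ⟶[ U ] w)
  ⟶[ U ]? v w = (w ∈? U) ×-dec (v ⟶ₘ? w)

  record Arena (U : Subset n) : Set where
    field
      m-stays        : ∀ {v} → v ∈ U → owner G v ≡ σ → m v ∈ U
      opponent-stays : ∀ {v} → v ∈ U → owner G v ≢ σ → ∃ λ w → w ∈ U × edge v w ≡ true
      winning-vertex : ∃ λ v → v ∈ U × Winning v

  module InArena {U} (arena : Arena U) where
    open Arena arena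
    open Reachability (λ v w → v ⟶[ U ] w) ⟶[ U ]? public
    open Equivalence

    m-move : ∀ {v} → v ∈ U → owner G v ≡ σ → v ⟶[ U ] m v
    m-move {v} v∈U σ-owns = m-stays v∈U σ-owns , m-legal v σ-owns , λ _ → refl

    opponent-move : ∀ {v w} → w ∈ U → owner G v ≢ σ → edge v w ≡ true → v ⟶[ U ] w
    opponent-move w∈U ¬σ-owns v→w = w∈U , v→w , λ σ-owns → ⊥-elim (¬σ-owns σ-owns)

    has-move : ∀ {v} → v ∈ U → ∃ λ w → v ⟶[ U ] w
    has-move {v} v∈U with owner G v ≟ₚ σ
    ... | yes σ-owns = m v , m-move v∈U σ-owns
    ... | no ¬σ-owns with opponent-stays v∈U ¬σ-owns
    ...   | w , w∈U , v→w = w , opponent-move w∈U ¬σ-owns v→w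

    ∈-⟶* : ∀ {v w} → v ∈ U → v ⟶* w → w ∈ U
    ∈-⟶* = closed-⟶* λ _ → proj₁

    winning-⟶* : ∀ {v w} → Winning v → v ⟶* w → Winning w
    winning-⟶* = closed-⟶* λ v-wins (_ , v⟶w) → winning-⟶ₘ v⟶w v-wins

    reach-⊆ : ∀ {y} → y ∈ U → reach y ⊆ U
    reach-⊆ y∈U w∈ = ∈-⟶* y∈U (to ∈reach⇔ w∈)

    reach-trap : ∀ {y} → y ∈ U → IsTrap G (opp σ) U (reach y)
    reach-trap {y} y∈U = reach-⊆ y∈U , (y , from ∈reach⇔ ε) , opponent-closed , σ-stays
      where
        opponent-closed : ∀ v → v ∈ reach y → owner G v ≡ opp σ →
                          ∀ w → w ∈ U → edge v w ≡ true → w ∈ reach y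
        opponent-closed v v∈ opp-owns w w∈U v→w =
          reach-closed v∈ (opponent-move w∈U (≡opp⇒≢ opp-owns) v→w)

        σ-stays : ∀ v → v ∈ reach y → owner G v ≢ opp σ → ∃ λ w → w ∈ reach y × edge v w ≡ true
        σ-stays v v∈ ¬opp-owns =
          m v , reach-closed v∈ (m-move (reach-⊆ y∈U v∈) σ-owns) , m-legal v σ-owns
          where
            σ-owns : owner G v ≡ σ
            σ-owns = ≢opp⇒≡ ¬opp-owns

    reach-winning : ∀ {y} → y ∈ U → Winning y → Terminal y → R G σ (reach y) ≡ true
    reach-winning {y} y∈U y-wins terminal with has-move y∈U
    ... | c , y⟶c with terminal-recurrentWalk terminal y⟶c
    ... | f , f0≡y , f-moves , inf⇔reachable
      with y-wins f (f0≡y , (λ i → proj₁ (proj₂ (f-moves i))) , (λ i → proj₂ (proj₂ (f-moves i))))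
    ... | S , S⇔inf , RS = subst (λ T → R G σ T ≡ true) S≡reach RS
      where
        S≡reach : S ≡ reach y
        S≡reach = ⊆-antisym (λ {w} w∈S → from ∈reach⇔ (to (inf⇔reachable w) (to (S⇔inf w) w∈S)))
                            (λ {w} w∈ → from (S⇔inf w) (from (inf⇔reachable w) (to ∈reach⇔ w∈)))

    subtrap-arena : ∀ {y Y} → y ∈ U → Winning y → IsTrap G σ (reach y) Y → Arena Y
    subtrap-arena {y} y∈U y-wins (Y⊆X , (w , w∈Y) , σ-closed , opponent-stays′) = record
      { m-stays        = λ {v} v∈Y σ-owns →
          σ-closed v v∈Y σ-owns (m v) (reach-closed (Y⊆X v∈Y) (m-move (reach-⊆ y∈U (Y⊆X v∈Y)) σ-owns))
                   (m-legal v σ-owns)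
      ; opponent-stays = λ {v} → opponent-stays′ v
      ; winning-vertex = w , w∈Y , winning-⟶* y-wins (to ∈reach⇔ (Y⊆X w∈Y))
      }

  trapDepthWin : ∀ {U} → Acc _⊂_ U → Arena U → TDWin G σ U
  trapDepthWin {U} (acc smaller) arena = respond (terminal-reachable v)
    where
      open InArena arena
      open Arena arena using (winning-vertex)

      v : Fin n
      v = proj₁ winning-vertex

      v∈U : v ∈ U
      v∈U = proj₁ (proj₂ winning-vertex)

      respond : (∃ λ y → v ⟶* y × Terminal y) → TDWin G σ U
      respond (y , v⟶*y , terminal) = tdwin (reach y) (reach-trap y∈U) X-wins answer
        where
          y∈U : y ∈ U
          y∈U = ∈-⟶* v∈U v⟶*y

          y-wins : Winning y
          y-wins = winning-⟶* (proj₂ (proj₂ winning-vertex)) v⟶*y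

          X-wins : R G σ (reach y) ≡ true
          X-wins = reach-winning y∈U y-wins terminal

          answer : ∀ Y → IsTrap G σ (reach y) Y → R G (opp σ) Y ≡ true → TDWin G σ Y
          answer Y Y-trap Y-wins = trapDepthWin
            (smaller (⊂-⊆-trans (⊆-R-opp⇒⊂ G σ (proj₁ Y-trap) X-wins Y-wins) (reach-⊆ y∈U)))
            (subtrap-arena y∈U y-wins Y-trap)

mainTheorem4 : (G : MullerGame) (σ : Player)
    → (∃ λ v → InWinningRegion G σ v)
    → HasMemorylessWinningStrategy G σ
    → WinsTrapDepthGame G σ
mainTheorem4 G σ (v , v-winning) (m , m-legal , m-wins) =
  trapDepthWin (⊂-wellFounded ⊤) record
    { m-stays        = λ _ _ → ∈⊤
    ; opponent-stays = λ {u} _ _ → let (w , u→w) = MullerGame.total G u in w , ∈⊤ , u→w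
    ; winning-vertex = v , ∈⊤ , m-wins v v-winning
    }
  where open MemorylessStrategy G σ m m-legal
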